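{- Let $d\ge1$, let $A,B\subseteq\{0,1\}^d$ be finite nonempty sets with $|A|\le|B|$, and let $P_1,P_2$ be constructed as in the context. If there exist $a\in A$ and $b\in B$ with $a\cdot b=0$, then $\mathrm{PAT}(P_1,P_2)\le |A|\cdot E_u-(E_u-E_s)$.
   Context: $\mathrm{EDIT}(x,y)$ is the edit distance (minimum number of single-symbol insertions, deletions, substitutions transforming $x$ into $y$). $\mathrm{PAT}(P_1,P_2)=\min_x\mathrm{EDIT}(P_1,x)$ over all contiguous substrings $x$ of $P_2$. $c^i$ denotes symbol $c$ repeated $i$ times; $\bigcirc$ denotes concatenation; $a\cdot b=\sum_j a_jb_j$. Construction: $l_0=1000d$, $l_1=(1000d)^2$, $l_2=(1000d)^3$. $\mathrm{CG}_1(0)=0^{l_1}0^{l_0}1^{l_0}1^{l_0}1^{l_0}0^{l_1}$, $\mathrm{CG}_1(1)=0^{l_1}0^{l_0}0^{l_0}0^{l_0}1^{l_0}0^{l_1}$, $\mathrm{CG}_2(0)=0^{l_1}0^{l_0}0^{l_0}1^{l_0}1^{l_0}0^{l_1}$, $\mathrm{CG}_2(1)=0^{l_1}1^{l_0}1^{l_0}1^{l_0}1^{l_0}0^{l_1}$, $g=0^{l_1/2-1}1\,0^{l_1/2}0^{l_0}1^{l_0}1^{l_0}1^{l_0}0^{l_1}$. For $a,b\in\{0,1\}^d$: $L=\bigcirc_{i=1}^d g$, $R=\bigcirc_{i=1}^d\mathrm{CG}_1(a_i)$, $D=\bigcirc_{i=1}^d\mathrm{CG}_2(b_i)$, $\mathrm{AG}_1(a)=0^{l_2}L1^{l_2}R0^{l_2}$,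 $\mathrm{AG}_2(b)=1^{l_2}D1^{l_2}$. $l=d(4l_0+2l_1)$, $E_s=2l_2+l+dl_0$, $E_u=l+2l_2+dl_0+d$. $t=\max(|\mathrm{AG}_1(a)|,|\mathrm{AG}_2(b)|)$, $T=1000d\cdot t$, $\mathrm{AG}_k'(v)=2^T\mathrm{AG}_k(v)2^T$, $f$ the all-ones vector. $P_1=\bigcirc_{a\in A}\mathrm{AG}_1'(a)$, $P_2=\left(\bigcirc_{i=1}^{|A|-1}\mathrm{AG}_2'(f)\right)\left(\bigcirc_{b\in B}\mathrm{AG}_2'(b)\right)\left(\bigcirc_{i=1}^{|A|-1}\mathrm{AG}_2'(f)\right)$ (any fixed orders of $A$, $B$). -}

module Defs where

open import Data.Nat using (ℕ; zero; suc; _+_; _*_; _∸_; _≤_; _⊔_; _/_)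
open import Data.Bool using (Bool; true; false)
open import Data.List using (List; []; _∷_; _++_; replicate; concat; concatMap; length)
open import Data.Vec as Vec using (Vec)
open import Data.Product using (Σ; ∃; _×_; _,_)
open import Relation.Binary.PropositionalEquality using (_≡_)
open import Relation.Binary.Construct.Closure.ReflexiveTransitive using (Star)

data Sym : Set where
  s0 s1 s2 : Sym

Str : Set
Str = List Sym

_^^_ : Sym → ℕ → Str
c ^^ i = replicate i c

data EditStep : Str → Str → Set where
  ins : ∀ u v c → EditStep (u ++ v) (u ++ c ∷ v)
  del : ∀ u v c → EditStep (u ++ c ∷ v) (u ++ v)
  sub : ∀ u v c c' → EditStep (u ++ c ∷ v) (u ++ c' ∷ v)

data EditSeq : ℕ → Str → Str → Set where
  done : ∀ {x} → EditSeq zero x x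
  step : ∀ {n x y z} → EditStep x y → EditSeq n y z → EditSeq (suc n) x z

EDIT≤ : Str → Str → ℕ → Set
EDIT≤ x y k = Σ ℕ λ n → n ≤ k × EditSeq n x y

PAT≤ : Str → Str → ℕ → Set
PAT≤ P₁ P₂ k = Σ Str λ u → Σ Str λ x → Σ Str λ v →
  (P₂ ≡ u ++ x ++ v) × EDIT≤ P₁ x k

bit : Bool → ℕ
bit true  = 1
bit false = 0

dot : ∀ {d} → Vec Bool d → Vec Bool d → ℕ
dot Vec.[] Vec.[] = 0
dot (x Vec.∷ a) (y Vec.∷ b) = bit x * bit y + dot a b

module Construction (d : ℕ) where

  l₀ l₁ l₂ : ℕ
  l₀ = 1000 * d
  l₁ = (1000 * d) * (1000 * d)
  l₂ = (1000 * d) * (1000 * d) * (1000 * d)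

  CG₁ : Bool → Str
  CG₁ false = s0 ^^ l₁ ++ s0 ^^ l₀ ++ s1 ^^ l₀ ++ s1 ^^ l₀ ++ s1 ^^ l₀ ++ s0 ^^ l₁
  CG₁ true  = s0 ^^ l₁ ++ s0 ^^ l₀ ++ s0 ^^ l₀ ++ s0 ^^ l₀ ++ s1 ^^ l₀ ++ s0 ^^ l₁

  CG₂ : Bool → Str
  CG₂ false = s0 ^^ l₁ ++ s0 ^^ l₀ ++ s0 ^^ l₀ ++ s1 ^^ l₀ ++ s1 ^^ l₀ ++ s0 ^^ l₁
  CG₂ true  = s0 ^^ l₁ ++ s1 ^^ l₀ ++ s1 ^^ l₀ ++ s1 ^^ l₀ ++ s1 ^^ l₀ ++ s0 ^^ l₁

  g : Str
  g = s0 ^^ (l₁ / 2 ∸ 1) ++ s1 ∷ [] ++ s0 ^^ (l₁ / 2)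
      ++ s0 ^^ l₀ ++ s1 ^^ l₀ ++ s1 ^^ l₀ ++ s1 ^^ l₀ ++ s0 ^^ l₁

  L : Str
  L = concat (replicate d g)

  R : Vec Bool d → Str
  R a = concatMap CG₁ (Vec.toList a)

  D : Vec Bool d → Str
  D b = concatMap CG₂ (Vec.toList b)

  AG₁ : Vec Bool d → Str
  AG₁ a = s0 ^^ l₂ ++ L ++ s1 ^^ l₂ ++ R a ++ s0 ^^ l₂

  AG₂ : Vec Bool d → Str
  AG₂ b = s1 ^^ l₂ ++ D b ++ s1 ^^ l₂

  l Es Eu : ℕ
  l  = d * (4 * l₀ + 2 * l₁)
  Es = 2 * l₂ + l + d * l₀
  Eu = l + 2 * l₂ + d * l₀ + d

  f : Vec Bool d
  f = Vec.replicate d true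

  -- t = max(|AG₁(a)|, |AG₂(b)|); these lengths do not depend on a, b,
  -- so they are computed on the all-ones vector.
  t T : ℕ
  t = length (AG₁ f) ⊔ length (AG₂ f)
  T = 1000 * d * t

  AG₁' AG₂' : Vec Bool d → Str
  AG₁' v = s2 ^^ T ++ AG₁ v ++ s2 ^^ T
  AG₂' v = s2 ^^ T ++ AG₂ v ++ s2 ^^ T

  P₁ : List (Vec Bool d) → Str
  P₁ A = concatMap AG₁' A

  P₂ : List (Vec Bool d) → List (Vec Bool d) → Str
  P₂ A B = concat (replicate (length A ∸ 1) (AG₂' f))
           ++ concatMap AG₂' B
           ++ concat (replicate (length A ∸ 1) (AG₂' f))

-- Edit costs add up under concatenation, so P₁ can be edited gadget by
-- gadget, and each gadget run by run.  Explicit run-by-run scripts show that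
-- AG₁(a) becomes AG₂(b) within E_u edits for all a, b, and within E_s edits
-- when a·b = 0; the 2^T guards are left untouched.  Write A = pre ++ a ∷ post
-- and B = preB ++ b ∷ postB.  P₂ is the gadget sequence F ++ B ++ F, where F
-- consists of |A| − 1 = |pre| + |post| copies of AG₂'(f), so it contains a
-- contiguous block of |pre| gadgets, then AG₂'(b), then |post| gadgets.
-- Aligning P₁ with this block gadget by gadget costs |pre|·E_u + E_s +
-- |post|·E_u = |A|·E_u − (E_u − E_s).
module Submission where

open import Defs
open import Data.Nat using (ℕ; zero; suc; _+_; _*_; _∸_; _/_; _≤_; s≤s; z≤n)
open import Data.Nat.Properties
open import Data.Nat.DivMod using (m*n/n≡m)
open import Data.Nat.Tactic.RingSolver using (solve-∀)
open import Data.Bool using (Bool; true; false)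
open import Data.List
  using (List; []; _∷_; _++_; replicate; concat; concatMap; length; take; drop)
open import Data.List.Properties
  using (++-assoc; ++-identityʳ; length-++; length-replicate; length-take; length-drop;
         take++drop≡id; concatMap-++; map-replicate)
open import Data.List.Relation.Unary.Unique.Propositional using (Unique)
open import Data.List.Membership.Propositional using (_∈_)
open import Data.List.Membership.Propositional.Properties using (∈-∃++)
open import Data.Vec as Vec using (Vec)
open import Data.Product using (Σ; _×_; _,_)
open import Function using (_∘_)
open import Relation.Binary.PropositionalEquality
  using (_≡_; _≢_; refl; sym; trans; cong; cong₂; subst₂; module ≡-Reasoning)

step-prefix : ∀ p {x y} → EditStep x y → EditStep (p ++ x) (p ++ y)
step-prefix p (ins u v c) =
  subst₂ EditStep (++-assoc p u v) (++-assoc p u (c ∷ v)) (ins (p ++ u) v c)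
step-prefix p (del u v c) =
  subst₂ EditStep (++-assoc p u (c ∷ v)) (++-assoc p u v) (del (p ++ u) v c)
step-prefix p (sub u v c c') =
  subst₂ EditStep (++-assoc p u (c ∷ v)) (++-assoc p u (c' ∷ v)) (sub (p ++ u) v c c')

step-suffix : ∀ s {x y} → EditStep x y → EditStep (x ++ s) (y ++ s)
step-suffix s (ins u v c) =
  subst₂ EditStep (sym (++-assoc u v s)) (sym (++-assoc u (c ∷ v) s)) (ins u (v ++ s) c)
step-suffix s (del u v c) =
  subst₂ EditStep (sym (++-assoc u (c ∷ v) s)) (sym (++-assoc u v s)) (del u (v ++ s) c)
step-suffix s (sub u v c c') =
  subst₂ EditStep (sym (++-assoc u (c ∷ v) s)) (sym (++-assoc u (c' ∷ v) s))
    (sub u (v ++ s) c c')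

seq-prefix : ∀ p {n x y} → EditSeq n x y → EditSeq n (p ++ x) (p ++ y)
seq-prefix p done       = done
seq-prefix p (step e r) = step (step-prefix p e) (seq-prefix p r)

seq-suffix : ∀ s {n x y} → EditSeq n x y → EditSeq n (x ++ s) (y ++ s)
seq-suffix s done       = done
seq-suffix s (step e r) = step (step-suffix s e) (seq-suffix s r)

seq-trans : ∀ {m n x y z} → EditSeq m x y → EditSeq n y z → EditSeq (m + n) x z
seq-trans done       r = r
seq-trans (step e q) r = step e (seq-trans q r)

edit-refl : ∀ {x} → EDIT≤ x x 0
edit-refl = 0 , z≤n , done

edit-weaken : ∀ {x y m n} → m ≤ n → EDIT≤ x y m → EDIT≤ x y n
edit-weaken m≤n (k , k≤m , s) = k , ≤-trans k≤m m≤n , s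

edit-cast : ∀ {x y m n} → m ≡ n → EDIT≤ x y m → EDIT≤ x y n
edit-cast = edit-weaken ∘ ≤-reflexive

edit-trans : ∀ {x y z m n} → EDIT≤ x y m → EDIT≤ y z n → EDIT≤ x z (m + n)
edit-trans (m' , m'≤m , s) (n' , n'≤n , t) = m' + n' , +-mono-≤ m'≤m n'≤n , seq-trans s t

edit-++ : ∀ {x y x' y' m n} → EDIT≤ x y m → EDIT≤ x' y' n → EDIT≤ (x ++ x') (y ++ y') (m + n)
edit-++ {y = y} {x' = x'} (m' , m'≤m , s) (n' , n'≤n , t) =
  m' + n' , +-mono-≤ m'≤m n'≤n , seq-trans (seq-suffix x' s) (seq-prefix y t)

substitute-one : ∀ u v c c' → EDIT≤ (u ++ c ∷ v) (u ++ c' ∷ v) 1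
substitute-one u v c c' = 1 , ≤-refl , step (sub u v c c') done

keep-run : ∀ c n → EDIT≤ (c ^^ n) (c ^^ n) 0
keep-run c n = edit-refl

delete-run : ∀ c n → EDIT≤ (c ^^ n) [] n
delete-run c zero = edit-refl
delete-run c (suc n) with delete-run c n
... | k , k≤n , s = suc k , s≤s k≤n , step (del [] (c ^^ n) c) s

substitute-run : ∀ c c' n → EDIT≤ (c ^^ n) (c' ^^ n) n
substitute-run c c' zero    = edit-refl
substitute-run c c' (suc n) =
  edit-++ {x = c ∷ []} (substitute-one [] [] c c') (substitute-run c c' n)

run-split : ∀ (c : Sym) m n → c ^^ (m + suc n) ≡ c ^^ m ++ c ∷ c ^^ n
run-split c zero    n = refl
run-split c (suc m) n = cong (c ∷_) (run-split c m n)

module _ {X : Set} (h₁ h₂ : X → Str) where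

  align-pairwise : ∀ {k} → (∀ x y → EDIT≤ (h₁ x) (h₂ y) k) →
    ∀ xs ys → length xs ≡ length ys →
    EDIT≤ (concatMap h₁ xs) (concatMap h₂ ys) (length xs * k)
  align-pairwise bound []       []       _  = edit-refl
  align-pairwise bound (x ∷ xs) (y ∷ ys) eq =
    edit-++ (bound x y) (align-pairwise bound xs ys (suc-injective eq))

  align-around : ∀ {k k' a b} → (∀ x y → EDIT≤ (h₁ x) (h₂ y) k) →
    EDIT≤ (h₁ a) (h₂ b) k' →
    ∀ pre post W₁ W₂ → length pre ≡ length W₁ → length post ≡ length W₂ →
    EDIT≤ (concatMap h₁ (pre ++ a ∷ post)) (concatMap h₂ (W₁ ++ b ∷ W₂))
      (length pre * k + (k' + length post * k))
  align-around bound cheap pre post W₁ W₂ |pre| |post| =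
    subst₂ (λ s t → EDIT≤ s t _)
      (sym (concatMap-++ h₁ pre _)) (sym (concatMap-++ h₂ W₁ _))
      (edit-++ (align-pairwise bound pre W₁ |pre|)
        (edit-++ cheap (align-pairwise bound post W₂ |post|)))

pat-block : ∀ {X : Set} {P S k} (h : X → Str) U W V →
  S ≡ concatMap h (U ++ W ++ V) → EDIT≤ P (concatMap h W) k → PAT≤ P S k
pat-block h U W V S≡ edit =
  concatMap h U , concatMap h W , concatMap h V ,
  trans S≡ (trans (concatMap-++ h U (W ++ V)) (cong (concatMap h U ++_) (concatMap-++ h W V))) ,
  edit

window : ∀ {X : Set} (U V : List X) (b : X) i j → i ≤ length U → j ≤ length V →
  Σ (List X) λ U₁ → Σ (List X) λ W₁ → Σ (List X) λ W₂ → Σ (List X) λ V₂ →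
    (U ++ b ∷ V ≡ U₁ ++ (W₁ ++ b ∷ W₂) ++ V₂) × length W₁ ≡ i × length W₂ ≡ j
window U V b i j i≤|U| j≤|V| =
  take n U , drop n U , take j V , drop j V , split ,
  trans (length-drop n U) (m∸[m∸n]≡n i≤|U|) ,
  trans (length-take j V) (m≤n⇒m⊓n≡m j≤|V|)
  where
  n = length U ∸ i
  open ≡-Reasoning
  split : U ++ b ∷ V ≡ take n U ++ (drop n U ++ b ∷ take j V) ++ drop j V
  split = begin
    U ++ b ∷ V
      ≡⟨ cong₂ (λ u v → u ++ b ∷ v) (sym (take++drop≡id n U)) (sym (take++drop≡id j V)) ⟩
    (take n U ++ drop n U) ++ b ∷ (take j V ++ drop j V)
      ≡⟨ ++-assoc (take n U) (drop n U) _ ⟩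
    take n U ++ (drop n U ++ b ∷ take j V ++ drop j V)
      ≡⟨ cong (take n U ++_) (sym (++-assoc (drop n U) (b ∷ take j V) (drop j V))) ⟩
    take n U ++ (drop n U ++ b ∷ take j V) ++ drop j V ∎

-- Cost of the script for orthogonal vectors, as summed by edit-++.
orthogonal-cost : ∀ n L₀ L₁ L₂ →
  L₂ + (n * (L₁ + (L₀ + (L₀ + (L₀ + (L₀ + L₁))))) + (0 + (n * L₀ + L₂)))
    ≡ 2 * L₂ + n * (4 * L₀ + 2 * L₁) + n * L₀
orthogonal-cost = solve-∀

-- Cost of the script for arbitrary vectors, as summed by edit-++.
generic-cost : ∀ n L₀ L₁ L₂ →
  L₂ + (n * (1 + L₀) + (0 + (n * (L₁ + (L₀ + (L₀ + (L₀ + (L₀ + L₁))))) + L₂)))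
    ≡ n * (4 * L₀ + 2 * L₁) + 2 * L₂ + n * L₀ + n
generic-cost = solve-∀

one-cheap-pair : ∀ p q {e u} → e ≤ u → p * u + (e + q * u) ≡ (p + suc q) * u ∸ (u ∸ e)
one-cheap-pair p q {e} {u} e≤u = sym (begin
  (p + suc q) * u ∸ (u ∸ e)        ≡⟨ cong (_∸ (u ∸ e)) (regroup p q u) ⟩
  (p * u + q * u) + u ∸ (u ∸ e)    ≡⟨ +-∸-assoc (p * u + q * u) (m∸n≤m u e) ⟩
  (p * u + q * u) + (u ∸ (u ∸ e))  ≡⟨ cong ((p * u + q * u) +_) (m∸[m∸n]≡n e≤u) ⟩
  (p * u + q * u) + e              ≡⟨ reorder (p * u) (q * u) e ⟩
  p * u + (e + q * u)              ∎)
  where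
  open ≡-Reasoning
  regroup : ∀ p q u → (p + suc q) * u ≡ (p * u + q * u) + u
  regroup = solve-∀
  reorder : ∀ x y z → (x + y) + z ≡ x + (z + y)
  reorder = solve-∀

module Gadgets (d : ℕ) (d≥1 : 1 ≤ d) where
  open Construction d

  cgLen : ℕ
  cgLen = l₁ + (l₀ + (l₀ + (l₀ + (l₀ + l₁))))

  -- The padding of g is 0^{h−1} 1 0^h with h = l₁/2; since l₁ is even and
  -- positive, this has length l₁.
  padding-split : l₁ / 2 ∸ 1 + suc (l₁ / 2) ≡ l₁
  padding-split = begin
    q ∸ 1 + suc q      ≡⟨ sym (+-assoc (q ∸ 1) 1 q) ⟩
    (q ∸ 1 + 1) + q    ≡⟨ cong (_+ q) (m∸n+n≡m q≥1) ⟩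
    q + q              ≡⟨ double q ⟩
    q * 2              ≡⟨ cong (_* 2) q≡q₀ ⟩
    q₀ * 2             ≡⟨ sym (l₁≡q*2 d) ⟩
    l₁                 ∎
    where
    open ≡-Reasoning
    l₁≡q*2 : ∀ n → (1000 * n) * (1000 * n) ≡ (500 * n * (1000 * n)) * 2
    l₁≡q*2 = solve-∀
    double : ∀ q → q + q ≡ q * 2
    double = solve-∀
    q₀ = 500 * d * (1000 * d)
    q = l₁ / 2
    q≡q₀ : q ≡ q₀
    q≡q₀ = trans (cong (_/ 2) (l₁≡q*2 d)) (m*n/n≡m q₀ 2)
    q≥1 : 1 ≤ q
    q≥1 = subst₂ _≤_ refl (sym q≡q₀)
      (*-mono-≤ (*-mono-≤ {1} {500} (s≤s z≤n) d≥1) (*-mono-≤ {1} {1000} (s≤s z≤n) d≥1))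

  tail₀ : Str
  tail₀ = s0 ^^ l₀ ++ s1 ^^ l₀ ++ s1 ^^ l₀ ++ s1 ^^ l₀ ++ s0 ^^ l₁

  -- g is CG₁(0) with the middle symbol of its left padding set to 1.
  g-to-CG₁ : EDIT≤ g (CG₁ false) 1
  g-to-CG₁ =
    subst₂ (λ s t → EDIT≤ s t 1) refl (sym CG₁-false-split)
      (substitute-one (s0 ^^ (l₁ / 2 ∸ 1)) (s0 ^^ (l₁ / 2) ++ tail₀) s1 s0)
    where
    CG₁-false-split : CG₁ false ≡ s0 ^^ (l₁ / 2 ∸ 1) ++ s0 ∷ s0 ^^ (l₁ / 2) ++ tail₀
    CG₁-false-split = begin
      s0 ^^ l₁ ++ tail₀
        ≡⟨ cong (λ n → s0 ^^ n ++ tail₀) (sym padding-split) ⟩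
      s0 ^^ (l₁ / 2 ∸ 1 + suc (l₁ / 2)) ++ tail₀
        ≡⟨ cong (_++ tail₀) (run-split s0 (l₁ / 2 ∸ 1) (l₁ / 2)) ⟩
      (s0 ^^ (l₁ / 2 ∸ 1) ++ s0 ∷ s0 ^^ (l₁ / 2)) ++ tail₀
        ≡⟨ ++-assoc (s0 ^^ (l₁ / 2 ∸ 1)) _ tail₀ ⟩
      s0 ^^ (l₁ / 2 ∸ 1) ++ s0 ∷ s0 ^^ (l₁ / 2) ++ tail₀ ∎
      where open ≡-Reasoning

  -- Orthogonal coordinates: CG₁(x) and CG₂(y) differ in exactly one run.
  coordinate-orthogonal : ∀ x y → bit x * bit y ≡ 0 → EDIT≤ (CG₁ x) (CG₂ y) l₀
  coordinate-orthogonal false false _ = edit-cast (+-identityʳ l₀)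
    (edit-++ (keep-run s0 l₁) (edit-++ (keep-run s0 l₀) (edit-++ (substitute-run s1 s0 l₀)
      (edit-++ (keep-run s1 l₀) (edit-++ (keep-run s1 l₀) (keep-run s0 l₁))))))
  coordinate-orthogonal false true _ = edit-cast (+-identityʳ l₀)
    (edit-++ (keep-run s0 l₁) (edit-++ (substitute-run s0 s1 l₀) (edit-++ (keep-run s1 l₀)
      (edit-++ (keep-run s1 l₀) (edit-++ (keep-run s1 l₀) (keep-run s0 l₁))))))
  coordinate-orthogonal true false _ = edit-cast (+-identityʳ l₀)
    (edit-++ (keep-run s0 l₁) (edit-++ (keep-run s0 l₀) (edit-++ (keep-run s0 l₀)
      (edit-++ (substitute-run s0 s1 l₀) (edit-++ (keep-run s1 l₀) (keep-run s0 l₁))))))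
  coordinate-orthogonal true true ()

  g-to-CG₂ : ∀ y → EDIT≤ g (CG₂ y) (1 + l₀)
  g-to-CG₂ y = edit-trans g-to-CG₁ (coordinate-orthogonal false y refl)

  delete-CG₁ : ∀ x → EDIT≤ (CG₁ x) [] cgLen
  delete-CG₁ false = edit-++ (delete-run s0 l₁) (edit-++ (delete-run s0 l₀)
    (edit-++ (delete-run s1 l₀) (edit-++ (delete-run s1 l₀)
      (edit-++ (delete-run s1 l₀) (delete-run s0 l₁)))))
  delete-CG₁ true = edit-++ (delete-run s0 l₁) (edit-++ (delete-run s0 l₀)
    (edit-++ (delete-run s0 l₀) (edit-++ (delete-run s0 l₀)
      (edit-++ (delete-run s1 l₀) (delete-run s0 l₁)))))

  delete-g : EDIT≤ g [] cgLen
  delete-g = edit-cast cost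
    (edit-++ (delete-run s0 (l₁ / 2 ∸ 1)) (edit-++ (delete-run s1 1)
      (edit-++ (delete-run s0 (l₁ / 2)) delete-tail₀)))
    where
    |tail₀| = l₀ + (l₀ + (l₀ + (l₀ + l₁)))
    delete-tail₀ : EDIT≤ tail₀ [] |tail₀|
    delete-tail₀ = edit-++ (delete-run s0 l₀) (edit-++ (delete-run s1 l₀)
      (edit-++ (delete-run s1 l₀) (edit-++ (delete-run s1 l₀) (delete-run s0 l₁))))
    cost : l₁ / 2 ∸ 1 + (suc (l₁ / 2) + |tail₀|) ≡ cgLen
    cost = trans (sym (+-assoc (l₁ / 2 ∸ 1) (suc (l₁ / 2)) |tail₀|)) (cong (_+ |tail₀|) padding-split)

  delete-R : ∀ {n} (a : Vec Bool n) → EDIT≤ (concatMap CG₁ (Vec.toList a)) [] (n * cgLen)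
  delete-R Vec.[]       = edit-refl
  delete-R (x Vec.∷ a) = edit-++ (delete-CG₁ x) (delete-R a)

  delete-L : ∀ n → EDIT≤ (concat (replicate n g)) [] (n * cgLen)
  delete-L zero    = edit-refl
  delete-L (suc n) = edit-++ delete-g (delete-L n)

  L-to-D : ∀ {n} (b : Vec Bool n) →
    EDIT≤ (concat (replicate n g)) (concatMap CG₂ (Vec.toList b)) (n * (1 + l₀))
  L-to-D Vec.[]       = edit-refl
  L-to-D (y Vec.∷ b) = edit-++ (g-to-CG₂ y) (L-to-D b)

  R-to-D : ∀ {n} (a b : Vec Bool n) → dot a b ≡ 0 →
    EDIT≤ (concatMap CG₁ (Vec.toList a)) (concatMap CG₂ (Vec.toList b)) (n * l₀)
  R-to-D Vec.[]       Vec.[]       _    = edit-refl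
  R-to-D (x Vec.∷ a) (y Vec.∷ b) a·b≡0 =
    edit-++ (coordinate-orthogonal x y (m+n≡0⇒m≡0 (bit x * bit y) a·b≡0))
      (R-to-D a b (m+n≡0⇒n≡0 (bit x * bit y) a·b≡0))

  AG-orthogonal : ∀ a b → dot a b ≡ 0 → EDIT≤ (AG₁ a) (AG₂ b) Es
  AG-orthogonal a b a·b≡0 = edit-cast (orthogonal-cost d l₀ l₁ l₂)
    (edit-++ (delete-run s0 l₂) (edit-++ (delete-L d) (edit-++ (keep-run s1 l₂)
      (edit-++ (R-to-D a b a·b≡0) (substitute-run s0 s1 l₂)))))

  AG-any : ∀ a b → EDIT≤ (AG₁ a) (AG₂ b) Eu
  AG-any a b = subst₂ (λ s t → EDIT≤ s t Eu) refl
    (cong (λ z → s1 ^^ l₂ ++ D b ++ z) (++-identityʳ (s1 ^^ l₂)))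
    (edit-cast (generic-cost d l₀ l₁ l₂)
      (edit-++ (substitute-run s0 s1 l₂) (edit-++ (L-to-D b) (edit-++ (keep-run s1 l₂)
        (edit-++ (delete-R a) (delete-run s0 l₂))))))

  guarded : ∀ a b {k} → EDIT≤ (AG₁ a) (AG₂ b) k → EDIT≤ (AG₁' a) (AG₂' b) k
  guarded a b {k} e =
    edit-cast (+-identityʳ k) (edit-++ (keep-run s2 T) (edit-++ e (keep-run s2 T)))

  -- The orthogonal script is never more expensive: E_u = E_s + d.
  Es≤Eu : Es ≤ Eu
  Es≤Eu = subst₂ _≤_ (reorder l l₂ (d * l₀)) refl (m≤m+n (l + 2 * l₂ + d * l₀) d)
    where
    reorder : ∀ l l₂ x → l + 2 * l₂ + x ≡ 2 * l₂ + l + x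
    reorder = solve-∀

  padding : List (Vec Bool d) → List (Vec Bool d)
  padding A = replicate (length A ∸ 1) f

  P₂-gadgets : ∀ A B → P₂ A B ≡ concatMap AG₂' (padding A ++ B ++ padding A)
  P₂-gadgets A B = begin
    F' ++ concatMap AG₂' B ++ F'
      ≡⟨ cong₂ (λ u v → u ++ concatMap AG₂' B ++ v) padding-gadgets padding-gadgets ⟩
    concatMap AG₂' (padding A) ++ concatMap AG₂' B ++ concatMap AG₂' (padding A)
      ≡⟨ cong (concatMap AG₂' (padding A) ++_) (sym (concatMap-++ AG₂' B (padding A))) ⟩
    concatMap AG₂' (padding A) ++ concatMap AG₂' (B ++ padding A)
      ≡⟨ sym (concatMap-++ AG₂' (padding A) (B ++ padding A)) ⟩
    concatMap AG₂' (padding A ++ B ++ padding A) ∎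
    where
    open ≡-Reasoning
    F' = concat (replicate (length A ∸ 1) (AG₂' f))
    padding-gadgets : F' ≡ concatMap AG₂' (padding A)
    padding-gadgets = cong concat (sym (map-replicate AG₂' (length A ∸ 1) f))

  padding-length : ∀ pre post (a : Vec Bool d) →
    length (padding (pre ++ a ∷ post)) ≡ length pre + length post
  padding-length pre post a =
    trans (length-replicate (length (pre ++ a ∷ post) ∸ 1))
      (trans (cong (_∸ 1) (length-++ pre)) (cong (_∸ 1) (+-suc (length pre) (length post))))

  P₂-window : ∀ pre post preB postB (a b : Vec Bool d) →
    Σ (List (Vec Bool d)) λ U₁ → Σ (List (Vec Bool d)) λ W₁ →
    Σ (List (Vec Bool d)) λ W₂ → Σ (List (Vec Bool d)) λ V₂ →
      (P₂ (pre ++ a ∷ post) (preB ++ b ∷ postB)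
         ≡ concatMap AG₂' (U₁ ++ (W₁ ++ b ∷ W₂) ++ V₂))
      × length W₁ ≡ length pre × length W₂ ≡ length post
  P₂-window pre post preB postB a b =
    let (U₁ , W₁ , W₂ , V₂ , split , |W₁| , |W₂|) =
          window (F ++ preB) (postB ++ F) b (length pre) (length post) room-before room-after
    in U₁ , W₁ , W₂ , V₂ ,
       trans (P₂-gadgets A B) (cong (concatMap AG₂') (trans regroup split)) ,
       |W₁| , |W₂|
    where
    A = pre ++ a ∷ post
    B = preB ++ b ∷ postB
    F = padding A
    room-before : length pre ≤ length (F ++ preB)
    room-before = subst₂ _≤_ refl
      (sym (trans (length-++ F) (cong (_+ length preB) (padding-length pre post a))))
      (≤-trans (m≤m+n (length pre) (length post)) (m≤m+n _ (length preB)))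
    room-after : length post ≤ length (postB ++ F)
    room-after = subst₂ _≤_ refl
      (sym (trans (length-++ postB) (cong (length postB +_) (padding-length pre post a))))
      (≤-trans (m≤n+m (length post) (length pre)) (m≤n+m _ (length postB)))
    regroup : F ++ B ++ F ≡ (F ++ preB) ++ b ∷ (postB ++ F)
    regroup = trans (cong (F ++_) (++-assoc preB (b ∷ postB) F)) (sym (++-assoc F preB _))

  total-cost : ∀ pre post (a : Vec Bool d) →
    length pre * Eu + (Es + length post * Eu) ≡ length (pre ++ a ∷ post) * Eu ∸ (Eu ∸ Es)
  total-cost pre post a = trans (one-cheap-pair (length pre) (length post) Es≤Eu)
    (cong (λ n → n * Eu ∸ (Eu ∸ Es)) (sym (length-++ pre)))

-- Split A and B at the orthogonal pair, cut the matching
-- window out of P₂, and align P₁ with it gadget by gadget.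
mainTheorem6 : (d : ℕ) → 1 ≤ d →
    (A B : List (Vec Bool d)) → Unique A → Unique B →
    A ≢ [] → B ≢ [] → length A ≤ length B →
    Σ (Vec Bool d) (λ a → Σ (Vec Bool d) (λ b → a ∈ A × b ∈ B × dot a b ≡ 0)) →
    PAT≤ (Construction.P₁ d A) (Construction.P₂ d A B)
    (length A * Construction.Eu d ∸ (Construction.Eu d ∸ Construction.Es d))
mainTheorem6 d d≥1 A B _ _ _ _ _ (a , b , a∈A , b∈B , a·b≡0)
  with ∈-∃++ a∈A | ∈-∃++ b∈B
... | pre , post , refl | preB , postB , refl =
  let (U₁ , W₁ , W₂ , V₂ , P₂≡ , |W₁| , |W₂|) = P₂-window pre post preB postB a b
  in pat-block AG₂' U₁ (W₁ ++ b ∷ W₂) V₂ P₂≡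
       (edit-cast (total-cost pre post a)
         (align-around AG₁' AG₂' (λ x y → guarded x y (AG-any x y))
           (guarded a b (AG-orthogonal a b a·b≡0)) pre post W₁ W₂ (sym |W₁|) (sym |W₂|)))
  where
  open Construction d
  open Gadgets d d≥1
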